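{- Let $G_1$ and $G_2$ be the signed graphs on vertex set $\{v_1,v_2,v_3,v_4,v_5\}$ with common underlying graph the gem graph, whose edges are $v_1v_2, v_1v_3, v_1v_4, v_1v_5, v_2v_3, v_3v_4, v_4v_5$. In $G_1$ the edge $v_4v_5$ is negative and all other edges are positive; in $G_2$ the edge $v_3v_4$ is negative and all other edges are positive. Then $G_1$ and $G_2$ are not switching isomorphic, yet \[ \mathsf E(G_1,x)=\mathsf E(G_2,x)=x(x-2)^2(x^2-3x+3),\qquad \mathsf O(G_1,x)=\mathsf O(G_2,x)=(x-1)^3(x-2)^2 . \] In particular, there exist non-switching-isomorphic signed graphs with the same underlying graph, the same even chromatic polynomial and the same odd chromatic polynomial.
   Context: A signed graph $\Sigma=(\Gamma,\sigma)$ is a finite simple graph $\Gamma$ with a signature $\sigma:E(\Gamma)\to\{\pm1\}$; edges with sign $+1$ are positive, those with $-1$ negative. Switching a vertex set $X\subseteq V(\Gamma)$ inverts the sign of every edge with exactly one endpoint in $X$. Two signed graphs on the same underlying graph are switching equivalent if one is obtained from the other by switching some $X$. Two signed graphs $\Sigma_1,\Sigma_2$ are isomorphic if there is a graph isomorphism of underlying graphs preserving edge signs, and switching isomorphic if $\Sigma_1$ is isomorphic to a signed graph switching equivalent to $\Sigma_2$. For an integer $\lambda\ge 0$, let $C_\lambda$ be the set of nonzero integers in $[-\lambda/2,\lambda/2]$ if $\lambda$ is even, and the set of integers in $[-(\lambda-1)/2,(\lambda-1)/2]$ if $\lambda$ is odd (so $|C_\lambda|=\lambda$). A proper $C_\lambda$-colouring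 of $\Sigma$ is a map $\kappa:V(\Gamma)\to C_\lambda$ with $\kappa(v)\ne\sigma(\{v,w\})\kappa(w)$ for every edge $\{v,w\}$. Let $f(\Sigma,\lambda)$ be the number of such colourings. There are unique polynomials $\mathsf E(\Sigma,x),\mathsf O(\Sigma,x)\in\mathbb Z[x]$ (the even and odd chromatic polynomials) with $f(\Sigma,\lambda)=\mathsf E(\Sigma,\lambda)$ for all even $\lambda\ge0$ and $f(\Sigma,\lambda)=\mathsf O(\Sigma,\lambda)$ for all odd $\lambda\ge0$. -}

module Defs where

open import Data.Nat as ℕ using (ℕ; zero; suc)
open import Data.Nat.DivMod using (_/_; _%_)
open import Data.Integer as ℤ using (ℤ; +_; -[1+_])
open import Data.Fin using (Fin; toℕ)
open import Data.Bool using (Bool; true; false; if_then_else_; _xor_)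
open import Data.Maybe using (Maybe; just; nothing)
open import Data.Sign using (Sign; opposite) renaming (+ to ⊕; - to ⊖)
open import Data.List using (List; []; _∷_; map; _++_; concatMap; length; filter; upTo)
open import Data.List.Relation.Unary.All using (All)
open import Data.List.Relation.Unary.All.Properties using ()
open import Data.Vec using (Vec; []; _∷_; lookup)
open import Data.Fin using () renaming (zero to f0)
open import Data.List using (allFin)
open import Data.Unit using (⊤; tt)
open import Data.Product using (Σ; ∃; _×_; _,_)
open import Relation.Binary.PropositionalEquality using (_≡_; _≢_)
open import Relation.Nullary using (Dec; yes; no; ¬_)
open import Relation.Nullary.Decidable using (¬?)
open import Function.Bundles using (_↔_; Inverse)
import Data.List.Relation.Unary.All as All

-- Signed graphs on vertex set Fin n.
-- sig u v = nothing : no edge between u and v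
-- sig u v = just s  : edge uv with sign s (⊕ positive, ⊖ negative)

SignedGraph : ℕ → Set
SignedGraph n = Fin n → Fin n → Maybe Sign

switch : ∀ {n} → (Fin n → Bool) → SignedGraph n → SignedGraph n
switch X g u v with g u v
... | nothing = nothing
... | just s  = just (if X u xor X v then opposite s else s)

SwitchingIsomorphic : ∀ {n} → SignedGraph n → SignedGraph n → Set
SwitchingIsomorphic {n} g₁ g₂ =
  Σ (Fin n ↔ Fin n) λ φ → Σ (Fin n → Bool) λ X →
    ∀ u v → g₁ u v ≡ switch X g₂ (Inverse.to φ u) (Inverse.to φ v)

-- Colour set C_λ as a list of integers (each element exactly once).

signℤ : Sign → ℤ
signℤ ⊕ = + 1
signℤ ⊖ = ℤ.- (+ 1)

nonzeroUpTo : ℕ → List ℤ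
nonzeroUpTo k = map (λ i → + suc i) (upTo k) ++ map -[1+_] (upTo k)

C : ℕ → List ℤ
C l with l % 2
... | zero  = nonzeroUpTo (l / 2)
... | suc _ = + 0 ∷ nonzeroUpTo (l / 2)

-- all maps Fin n → L, represented as vectors of values
assignments : (n : ℕ) → List ℤ → List (Vec ℤ n)
assignments zero    L = [] ∷ []
assignments (suc n) L = concatMap (λ c → map (c ∷_) (assignments n L)) L

EdgeOK : Maybe Sign → ℤ → ℤ → Set
EdgeOK nothing  a b = ⊤
EdgeOK (just s) a b = a ≢ signℤ s ℤ.* b

edgeOK? : ∀ m a b → Dec (EdgeOK m a b)
edgeOK? nothing  a b = yes tt
edgeOK? (just s) a b = ¬? (a ℤ.≟ signℤ s ℤ.* b)

Proper : ∀ {n} → SignedGraph n → Vec ℤ n → Set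
Proper {n} g κ = All (λ u → All (λ v → EdgeOK (g u v) (lookup κ u) (lookup κ v)) (allFin n)) (allFin n)

proper? : ∀ {n} (g : SignedGraph n) κ → Dec (Proper g κ)
proper? {n} g κ = All.all? (λ u → All.all? (λ v → edgeOK? (g u v) (lookup κ u) (lookup κ v)) (allFin n)) (allFin n)

f : ∀ {n} → SignedGraph n → ℕ → ℕ
f {n} g l = length (filter (proper? g) (assignments n (C l)))

-- The gem graph on v1..v5 (v_i = Fin index i-1), edges
-- v1v2 v1v3 v1v4 v1v5 v2v3 v3v4 v4v5.  gemSig a b gives the signs of
-- v3v4 and v4v5; all other edges positive.

gemℕ : Sign → Sign → ℕ → ℕ → Maybe Sign
gemℕ a b 0 1 = just ⊕
gemℕ a b 1 0 = just ⊕
gemℕ a b 0 2 = just ⊕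
gemℕ a b 2 0 = just ⊕
gemℕ a b 0 3 = just ⊕
gemℕ a b 3 0 = just ⊕
gemℕ a b 0 4 = just ⊕
gemℕ a b 4 0 = just ⊕
gemℕ a b 1 2 = just ⊕
gemℕ a b 2 1 = just ⊕
gemℕ a b 2 3 = just a
gemℕ a b 3 2 = just a
gemℕ a b 3 4 = just b
gemℕ a b 4 3 = just b
gemℕ a b _ _ = nothing

G₁ : SignedGraph 5
G₁ u v = gemℕ ⊕ ⊖ (toℕ u) (toℕ v)

G₂ : SignedGraph 5
G₂ u v = gemℕ ⊖ ⊕ (toℕ u) (toℕ v)

Epoly : ℤ → ℤ
Epoly x = x ℤ.* ((x ℤ.- + 2) ℤ.* (x ℤ.- + 2)) ℤ.* (x ℤ.* x ℤ.- + 3 ℤ.* x ℤ.+ + 3)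

Opoly : ℤ → ℤ
Opoly x = (x ℤ.- + 1) ℤ.* (x ℤ.- + 1) ℤ.* (x ℤ.- + 1) ℤ.* ((x ℤ.- + 2) ℤ.* (x ℤ.- + 2))

{-# OPTIONS --safe #-}
module Submission where

-- The gem is v₁ joined to every vertex of the path v₂v₃v₄v₅.  Colour v₁, v₃, v₄ first: then
-- v₂ and v₅ each have two coloured neighbours and admit N − 2 + [the two forbidden colours
-- coincide] colours, N = |C_λ|.  Summing out v₄ and v₃ by Kronecker-delta sifting gives, for
-- both graphs, (N − 2)² (N (N − 1) (N − 2) + z), where z is the number of colours x with
-- −x ≠ x, i.e. z = N for even λ and z = N − 1 for odd λ.
--
-- Switching preserves the sign of every triangle, so a switching isomorphism maps the negative
-- triangle v₁v₄v₅ of G₁ onto a negative triangle of G₂.  But in G₁ the vertex v₅ has only the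
-- neighbours v₁ and v₄, whereas every vertex of a negative triangle of G₂ has a third neighbour.

open import Defs
open import Data.Nat as ℕ using (ℕ; suc)
open import Data.Maybe using (just)
open import Data.Sign using (Sign; opposite) renaming (+ to ⊕; - to ⊖; _*_ to _*ₛ_)
open import Data.Product using (_×_; _,_; proj₁; proj₂; ∃-syntax)
open import Data.Sum using (_⊎_; inj₁; inj₂)
open import Function using (_∘_)
open import Relation.Binary.PropositionalEquality
open import Relation.Nullary using (¬_; ¬?; _×-dec_)

module ChromaticCounts where

  open import Data.Integer using (ℤ; +_; -[1+_]; _+_; _*_; -_; _-_; _≟_)
  open import Data.Integer.Properties
  open import Data.Integer.Tactic.RingSolver using (solve-∀)
  import Data.Nat.Properties as ℕ
  open import Data.Nat.DivMod using (_%_; _/_; m*n%n≡0; m*n/n≡m; [m+kn]%n≡m%n; +-distrib-/-∣ʳ)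
  open import Data.Nat.Divisibility using (divides)
  open import Data.Bool using (if_then_else_)
  open import Data.Unit using (tt)
  open import Data.List using (List; []; _∷_; map; _++_; length; filter; concatMap; upTo)
  open import Data.List.Properties using (length-++; length-map; length-upTo)
  open import Data.List.Membership.Propositional using (_∈_)
  open import Data.List.Membership.Propositional.Properties using (∈-map⁺; ∈-map⁻; ∈-++⁺ˡ; ∈-++⁺ʳ; ∈-++⁻)
  open import Data.List.Relation.Unary.Any using (here; there)
  open import Data.List.Relation.Unary.All as All using (All; []; _∷_)
  open import Data.List.Relation.Unary.AllPairs using (_∷_)
  open import Data.List.Relation.Unary.Unique.Propositional using (Unique)
  import Data.List.Relation.Unary.Unique.Propositional.Properties as Unique
  open import Data.Fin using (toℕ)
  open import Data.Vec using (Vec; []; _∷_)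
  open import Function using (_⇔_; mk⇔; Equivalence)
  open import Relation.Nullary using (Dec; yes; no; does; contradiction)
  open import Relation.Unary using (Pred; Decidable)

  private
    variable
      A B : Set
      P Q : Set

  gem : Sign → Sign → SignedGraph 5
  gem s t u v = gemℕ s t (toℕ u) (toℕ v)

  ∑ : List A → (A → ℤ) → ℤ
  ∑ []       h = + 0
  ∑ (x ∷ xs) h = h x + ∑ xs h

  infix 5 ∑
  syntax ∑ xs (λ x → e) = ∑[ x ∈ xs ] e

  ∑-cong : (xs : List A) {h h′ : A → ℤ} → (∀ {x} → x ∈ xs → h x ≡ h′ x) → ∑ xs h ≡ ∑ xs h′
  ∑-cong []       eq = refl
  ∑-cong (x ∷ xs) eq = cong₂ _+_ (eq (here refl)) (∑-cong xs (eq ∘ there))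

  ∑-++ : (xs ys : List A) (h : A → ℤ) → ∑ (xs ++ ys) h ≡ ∑ xs h + ∑ ys h
  ∑-++ []       ys h = sym (+-identityˡ _)
  ∑-++ (x ∷ xs) ys h = trans (cong (_+_ (h x)) (∑-++ xs ys h)) (sym (+-assoc (h x) _ _))

  ∑-map : (g : A → B) (xs : List A) (h : B → ℤ) → ∑ (map g xs) h ≡ ∑ xs (h ∘ g)
  ∑-map g []       h = refl
  ∑-map g (x ∷ xs) h = cong (_+_ (h (g x))) (∑-map g xs h)

  ∑-concatMap : (g : A → List B) (xs : List A) (h : B → ℤ) → ∑ (concatMap g xs) h ≡ ∑[ x ∈ xs ] ∑ (g x) h
  ∑-concatMap g []       h = refl
  ∑-concatMap g (x ∷ xs) h = trans (∑-++ (g x) _ h) (cong (_+_ (∑ (g x) h)) (∑-concatMap g xs h))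

  ∑-distrib-+ : (xs : List A) (h h′ : A → ℤ) → ∑[ x ∈ xs ] h x + h′ x ≡ ∑ xs h + ∑ xs h′
  ∑-distrib-+ []       h h′ = refl
  ∑-distrib-+ (x ∷ xs) h h′ =
    trans (cong (_+_ (h x + h′ x)) (∑-distrib-+ xs h h′)) (interchange (h x) (h′ x) _ _)
    where
    interchange : ∀ a b c d → a + b + (c + d) ≡ a + c + (b + d)
    interchange = solve-∀

  ∑-distrib-- : (xs : List A) (h h′ : A → ℤ) → ∑[ x ∈ xs ] h x - h′ x ≡ ∑ xs h - ∑ xs h′
  ∑-distrib-- []       h h′ = refl
  ∑-distrib-- (x ∷ xs) h h′ =
    trans (cong (_+_ (h x - h′ x)) (∑-distrib-- xs h h′)) (interchange (h x) (h′ x) _ _)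
    where
    interchange : ∀ a b c d → a - b + (c - d) ≡ a + c - (b + d)
    interchange = solve-∀

  ∑-*ˡ : (xs : List A) (k : ℤ) (h : A → ℤ) → ∑[ x ∈ xs ] k * h x ≡ k * ∑ xs h
  ∑-*ˡ []       k h = sym (*-zeroʳ k)
  ∑-*ˡ (x ∷ xs) k h = trans (cong (_+_ (k * h x)) (∑-*ˡ xs k h)) (sym (*-distribˡ-+ k (h x) _))

  ∑-*ʳ : (xs : List A) (k : ℤ) (h : A → ℤ) → ∑[ x ∈ xs ] h x * k ≡ ∑ xs h * k
  ∑-*ʳ xs k h = trans (∑-cong xs λ {x} _ → *-comm (h x) k) (trans (∑-*ˡ xs k h) (*-comm k _))

  ∑-const : (xs : List A) (k : ℤ) → ∑[ x ∈ xs ] k ≡ + length xs * k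
  ∑-const []       k = sym (*-zeroˡ k)
  ∑-const (x ∷ xs) k = trans (cong (_+_ k) (∑-const xs k)) (sym (suc-* (+ length xs) k))

  ∑-comm : (xs : List A) (ys : List B) (h : A → B → ℤ) →
           ∑[ x ∈ xs ] ∑[ y ∈ ys ] h x y ≡ ∑[ y ∈ ys ] ∑[ x ∈ xs ] h x y
  ∑-comm []       ys h = sym (trans (∑-const ys (+ 0)) (*-zeroʳ (+ length ys)))
  ∑-comm (x ∷ xs) ys h = trans (cong (_+_ (∑ ys (h x))) (∑-comm xs ys h)) (sym (∑-distrib-+ ys (h x) _))

  ∑-*-∑ : (xs : List A) (ys : List B) (g : A → ℤ) (h : B → ℤ) →
          ∑[ x ∈ xs ] ∑[ y ∈ ys ] g x * h y ≡ ∑ xs g * ∑ ys h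
  ∑-*-∑ xs ys g h = trans (∑-cong xs λ {x} _ → ∑-*ˡ ys (g x) h) (∑-*ʳ xs (∑ ys h) g)

  ∑-∑-factor : (xs : List A) (ys : List B) (k : ℤ) (g : A → ℤ) (h : B → ℤ) →
               ∑[ x ∈ xs ] ∑[ y ∈ ys ] k * (g x * h y) ≡ k * (∑ xs g * ∑ ys h)
  ∑-∑-factor xs ys k g h =
    trans (∑-cong xs λ _ → ∑-*ˡ ys k _) (trans (∑-*ˡ xs k _) (cong (_*_ k) (∑-*-∑ xs ys g h)))

  𝟙 : Dec P → ℤ
  𝟙 P? = if does P? then + 1 else + 0

  _≢?_ : (x y : ℤ) → Dec (x ≢ y)
  x ≢? y = ¬? (x ≟ y)

  ⟦_≡_⟧ : ℤ → ℤ → ℤ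
  ⟦ x ≡ y ⟧ = 𝟙 (x ≟ y)

  ⟦_≢_⟧ : ℤ → ℤ → ℤ
  ⟦ x ≢ y ⟧ = 𝟙 (x ≢? y)

  𝟙-yes : (P? : Dec P) → P → 𝟙 P? ≡ + 1
  𝟙-yes (yes _) p = refl
  𝟙-yes (no ¬p) p = contradiction p ¬p

  𝟙-no : (P? : Dec P) → ¬ P → 𝟙 P? ≡ + 0
  𝟙-no (yes p) ¬p = contradiction p ¬p
  𝟙-no (no _)  ¬p = refl

  𝟙-¬ : (P? : Dec P) → 𝟙 (¬? P?) ≡ + 1 - 𝟙 P?
  𝟙-¬ (yes _) = refl
  𝟙-¬ (no _)  = refl

  𝟙-× : (P? : Dec P) (Q? : Dec Q) → 𝟙 (P? ×-dec Q?) ≡ 𝟙 P? * 𝟙 Q?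
  𝟙-× (yes _) (yes _) = refl
  𝟙-× (yes _) (no _)  = refl
  𝟙-× (no _)  _       = refl

  𝟙-⇔ : P ⇔ Q → (P? : Dec P) (Q? : Dec Q) → 𝟙 P? ≡ 𝟙 Q?
  𝟙-⇔ P⇔Q P? (yes q) = 𝟙-yes P? (Equivalence.from P⇔Q q)
  𝟙-⇔ P⇔Q P? (no ¬q) = 𝟙-no P? (¬q ∘ Equivalence.to P⇔Q)

  ⟦≢⟧-sym : ∀ x y → ⟦ x ≢ y ⟧ ≡ ⟦ y ≢ x ⟧
  ⟦≢⟧-sym x y = 𝟙-⇔ (mk⇔ (_∘ sym) (_∘ sym)) (x ≢? y) (y ≢? x)

  ⟦≡-⟧-swap : ∀ x y → ⟦ x ≡ - y ⟧ ≡ ⟦ y ≡ - x ⟧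
  ⟦≡-⟧-swap x y = 𝟙-⇔ (mk⇔ swap swap) (x ≟ - y) (y ≟ - x)
    where
    swap : ∀ {x y} → x ≡ - y → y ≡ - x
    swap {x} {y} x≡-y = trans (sym (neg-involutive y)) (cong -_ (sym x≡-y))

  ⟦≢⟧-cong : ∀ x y {u v} → (x ≢ y → u ≡ v) → ⟦ x ≢ y ⟧ * u ≡ ⟦ x ≢ y ⟧ * v
  ⟦≢⟧-cong x y u≡v with x ≟ y
  ... | yes _   = refl
  ... | no  x≢y = cong (_*_ (+ 1)) (u≡v x≢y)

  ⟦≡⟧-off : ∀ {x y} → x ≢ y → ⟦ y ≡ x ⟧ ≡ + 0
  ⟦≡⟧-off {x} {y} x≢y = 𝟙-no (y ≟ x) (x≢y ∘ sym)

  ∑-≢-cong : (xs : List ℤ) (a : ℤ) {h h′ : ℤ → ℤ} → (∀ {x} → x ≢ a → h x ≡ h′ x) →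
             ∑[ x ∈ xs ] ⟦ x ≢ a ⟧ * h x ≡ ∑[ x ∈ xs ] ⟦ x ≢ a ⟧ * h′ x
  ∑-≢-cong xs a h≡h′ = ∑-cong xs λ {x} _ → ⟦≢⟧-cong x a h≡h′

  length-filter : {P : Pred A _} (P? : Decidable P) (xs : List A) →
                  + length (filter P? xs) ≡ ∑[ x ∈ xs ] 𝟙 (P? x)
  length-filter P? []       = refl
  length-filter P? (x ∷ xs) with P? x
  ... | yes _ = cong (_+_ (+ 1)) (length-filter P? xs)
  ... | no _  = trans (length-filter P? xs) (sym (+-identityˡ _))

  count-≡-∉ : ∀ {a} {xs : List ℤ} → All (a ≢_) xs → ∑[ x ∈ xs ] ⟦ x ≡ a ⟧ ≡ + 0
  count-≡-∉ []         = refl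
  count-≡-∉ (a≢y ∷ a∉) = cong₂ _+_ (⟦≡⟧-off a≢y) (count-≡-∉ a∉)

  count-≡ : ∀ {a} {xs : List ℤ} → Unique xs → a ∈ xs → ∑[ x ∈ xs ] ⟦ x ≡ a ⟧ ≡ + 1
  count-≡ {a} (a∉ ∷ _) (here refl) = cong₂ _+_ (𝟙-yes (a ≟ a) refl) (count-≡-∉ a∉)
  count-≡     (y∉ ∷ u) (there a∈)  = cong₂ _+_ (⟦≡⟧-off (All.lookup y∉ a∈ ∘ sym)) (count-≡ u a∈)

  module _ {xs : List ℤ} (unique : Unique xs) where
    open ≡-Reasoning

    ∑-sift : ∀ {a} → a ∈ xs → (h : ℤ → ℤ) → ∑[ x ∈ xs ] ⟦ x ≡ a ⟧ * h x ≡ h a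
    ∑-sift {a} a∈ h = begin
      ∑[ x ∈ xs ] ⟦ x ≡ a ⟧ * h x     ≡⟨ ∑-cong xs (λ {x} _ → at-a x) ⟩
      ∑[ x ∈ xs ] ⟦ x ≡ a ⟧ * h a     ≡⟨ ∑-*ʳ xs (h a) _ ⟩
      (∑[ x ∈ xs ] ⟦ x ≡ a ⟧) * h a   ≡⟨ cong (_* h a) (count-≡ unique a∈) ⟩
      + 1 * h a                       ≡⟨ *-identityˡ (h a) ⟩
      h a                             ∎
      where
      at-a : ∀ x → ⟦ x ≡ a ⟧ * h x ≡ ⟦ x ≡ a ⟧ * h a
      at-a x with x ≟ a
      ... | yes refl = refl
      ... | no _     = refl

    ∑-≢ : ∀ {a} → a ∈ xs → (h : ℤ → ℤ) → ∑[ x ∈ xs ] ⟦ x ≢ a ⟧ * h x ≡ ∑ xs h - h a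
    ∑-≢ {a} a∈ h = begin
      ∑[ x ∈ xs ] ⟦ x ≢ a ⟧ * h x             ≡⟨ ∑-cong xs (λ {x} _ → complement x) ⟩
      ∑[ x ∈ xs ] h x - ⟦ x ≡ a ⟧ * h x       ≡⟨ ∑-distrib-- xs h _ ⟩
      ∑ xs h - (∑[ x ∈ xs ] ⟦ x ≡ a ⟧ * h x)  ≡⟨ cong (_-_ (∑ xs h)) (∑-sift a∈ h) ⟩
      ∑ xs h - h a                            ∎
      where
      complement : ∀ x → ⟦ x ≢ a ⟧ * h x ≡ h x - ⟦ x ≡ a ⟧ * h x
      complement x = trans (cong (_* h x) (𝟙-¬ (x ≟ a))) (ring ⟦ x ≡ a ⟧ (h x))
        where
        ring : ∀ e y → (+ 1 - e) * y ≡ y - e * y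
        ring = solve-∀

    count-≢ : ∀ {a} → a ∈ xs → ∑[ x ∈ xs ] ⟦ x ≢ a ⟧ ≡ + length xs - + 1
    count-≢ {a} a∈ = begin
      ∑[ x ∈ xs ] ⟦ x ≢ a ⟧        ≡⟨ ∑-cong xs (λ {x} _ → sym (*-identityʳ ⟦ x ≢ a ⟧)) ⟩
      ∑[ x ∈ xs ] ⟦ x ≢ a ⟧ * + 1  ≡⟨ ∑-≢ a∈ (λ _ → + 1) ⟩
      (∑[ x ∈ xs ] + 1) - + 1      ≡⟨ cong (_- + 1) (trans (∑-const xs (+ 1)) (*-identityʳ (+ length xs))) ⟩
      + length xs - + 1            ∎

    count-≢₂ : ∀ {a b} → a ∈ xs → b ∈ xs →
               ∑[ x ∈ xs ] ⟦ x ≢ a ⟧ * ⟦ x ≢ b ⟧ ≡ + length xs - + 2 + ⟦ a ≡ b ⟧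
    count-≢₂ {a} {b} a∈ b∈ = begin
      ∑[ x ∈ xs ] ⟦ x ≢ a ⟧ * ⟦ x ≢ b ⟧      ≡⟨ ∑-≢ a∈ (λ x → ⟦ x ≢ b ⟧) ⟩
      (∑[ x ∈ xs ] ⟦ x ≢ b ⟧) - ⟦ a ≢ b ⟧    ≡⟨ cong₂ _-_ (count-≢ b∈) (𝟙-¬ (a ≟ b)) ⟩
      + length xs - + 1 - (+ 1 - ⟦ a ≡ b ⟧)  ≡⟨ ring (+ length xs) ⟦ a ≡ b ⟧ ⟩
      + length xs - + 2 + ⟦ a ≡ b ⟧          ∎
      where
      ring : ∀ n e → n - + 1 - (+ 1 - e) ≡ n - + 2 + e
      ring = solve-∀

  ∑-assignments : ∀ n (L : List ℤ) (h : Vec ℤ (suc n) → ℤ) →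
                  ∑ (assignments (suc n) L) h ≡ ∑[ c ∈ L ] ∑[ v ∈ assignments n L ] h (c ∷ v)
  ∑-assignments n L h = trans (∑-concatMap _ L h) (∑-cong L λ {c} _ → ∑-map (c ∷_) (assignments n L) h)

  -- v₂ and v₅ are summed innermost, as they are the two vertices of degree two.
  ∑-assignments-gem : (L : List ℤ) (h : Vec ℤ 5 → ℤ) →
    ∑ (assignments 5 L) h ≡ ∑[ a ∈ L ] ∑[ c ∈ L ] ∑[ d ∈ L ] ∑[ b ∈ L ] ∑[ e ∈ L ] h (a ∷ b ∷ c ∷ d ∷ e ∷ [])
  ∑-assignments-gem L h = begin
    ∑ (assignments 5 L) h
      ≡⟨ trans (∑-assignments 4 L h) (∑-cong L λ {a} _ →
         trans (∑-assignments 3 L _) (∑-cong L λ {b} _ →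
         trans (∑-assignments 2 L _) (∑-cong L λ {c} _ →
         trans (∑-assignments 1 L _) (∑-cong L λ {d} _ →
         trans (∑-assignments 0 L _) (∑-cong L λ {e} _ →
         +-identityʳ (h (a ∷ b ∷ c ∷ d ∷ e ∷ []))))))) ⟩
    ∑[ a ∈ L ] ∑[ b ∈ L ] ∑[ c ∈ L ] ∑[ d ∈ L ] ∑[ e ∈ L ] h (a ∷ b ∷ c ∷ d ∷ e ∷ [])
      ≡⟨ ∑-cong L (λ _ → ∑-comm L L _) ⟩
    ∑[ a ∈ L ] ∑[ c ∈ L ] ∑[ b ∈ L ] ∑[ d ∈ L ] ∑[ e ∈ L ] h (a ∷ b ∷ c ∷ d ∷ e ∷ [])
      ≡⟨ ∑-cong L (λ _ → ∑-cong L λ _ → ∑-comm L L _) ⟩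
    ∑[ a ∈ L ] ∑[ c ∈ L ] ∑[ d ∈ L ] ∑[ b ∈ L ] ∑[ e ∈ L ] h (a ∷ b ∷ c ∷ d ∷ e ∷ []) ∎
    where open ≡-Reasoning

  signed : Sign → ℤ → ℤ
  signed ⊕ x = x
  signed ⊖ x = - x

  signℤ-* : ∀ s x → signℤ s * x ≡ signed s x
  signℤ-* ⊕ x = *-identityˡ x
  signℤ-* ⊖ x = -1*i≡-i x

  signed-involutive : ∀ s x → signed s (signed s x) ≡ x
  signed-involutive ⊕ x = refl
  signed-involutive ⊖ x = neg-involutive x

  ≢-signed-sym : ∀ s {x y} → x ≢ signed s y → y ≢ signed s x
  ≢-signed-sym s {x} x≢sy y≡sx = x≢sy (sym (trans (cong (signed s) y≡sx) (signed-involutive s x)))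

  edgeOK⇔ : ∀ s {x y} → EdgeOK (just s) x y ⇔ x ≢ signed s y
  edgeOK⇔ s {y = y} = mk⇔ (λ ok eq → ok (trans eq (sym (signℤ-* s y))))
                          (λ ne eq → ne (trans eq (signℤ-* s y)))

  GemProper : Sign → Sign → ℤ → ℤ → ℤ → ℤ → ℤ → Set
  GemProper s t a b c d e =
    (c ≢ a × d ≢ a × d ≢ signed s c) × (b ≢ a × b ≢ c) × (e ≢ a × e ≢ signed t d)

  gemProper? : ∀ s t a b c d e → Dec (GemProper s t a b c d e)
  gemProper? s t a b c d e =
    (c ≢? a ×-dec d ≢? a ×-dec d ≢? signed s c) ×-dec (b ≢? a ×-dec b ≢? c) ×-dec (e ≢? a ×-dec e ≢? signed t d)

  -- Proper checks every ordered pair of vertices, so each edge occurs twice: to reads one copy,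
  -- from rebuilds the other with ≢-signed-sym.
  proper-gem⇔ : ∀ s t a b c d e → Proper (gem s t) (a ∷ b ∷ c ∷ d ∷ e ∷ []) ⇔ GemProper s t a b c d e
  proper-gem⇔ s t a b c d e = mk⇔ to from
    where
    ok : ∀ σ {x y} → EdgeOK (just σ) x y → x ≢ signed σ y
    ok σ = Equivalence.to (edgeOK⇔ σ)
    edge : ∀ σ {x y} → x ≢ signed σ y → EdgeOK (just σ) x y
    edge σ = Equivalence.from (edgeOK⇔ σ)
    edge′ : ∀ σ {x y} → y ≢ signed σ x → EdgeOK (just σ) x y
    edge′ σ = edge σ ∘ ≢-signed-sym σ
    to : Proper (gem s t) (a ∷ b ∷ c ∷ d ∷ e ∷ []) → GemProper s t a b c d e
    to (_ ∷ (ba ∷ _ ∷ bc ∷ _) ∷ (ca ∷ _) ∷ (da ∷ _ ∷ dc ∷ _) ∷ (ea ∷ _ ∷ _ ∷ ed ∷ _) ∷ []) =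
      (ok ⊕ ca , ok ⊕ da , ok s dc) , (ok ⊕ ba , ok ⊕ bc) , (ok ⊕ ea , ok t ed)
    from : GemProper s t a b c d e → Proper (gem s t) (a ∷ b ∷ c ∷ d ∷ e ∷ [])
    from ((c≢a , d≢a , d≢c) , (b≢a , b≢c) , (e≢a , e≢d)) =
      (tt ∷ edge′ ⊕ b≢a ∷ edge′ ⊕ c≢a ∷ edge′ ⊕ d≢a ∷ edge′ ⊕ e≢a ∷ []) ∷
      (edge ⊕ b≢a ∷ tt ∷ edge ⊕ b≢c ∷ tt ∷ tt ∷ []) ∷
      (edge ⊕ c≢a ∷ edge′ ⊕ b≢c ∷ tt ∷ edge′ s d≢c ∷ tt ∷ []) ∷
      (edge ⊕ d≢a ∷ tt ∷ edge s d≢c ∷ tt ∷ edge′ t e≢d ∷ []) ∷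
      (edge ⊕ e≢a ∷ tt ∷ tt ∷ edge t e≢d ∷ tt ∷ []) ∷ []

  𝟙-proper-gem : ∀ s t a b c d e → 𝟙 (proper? (gem s t) (a ∷ b ∷ c ∷ d ∷ e ∷ [])) ≡
    (⟦ c ≢ a ⟧ * (⟦ d ≢ a ⟧ * ⟦ d ≢ signed s c ⟧)) * ((⟦ b ≢ a ⟧ * ⟦ b ≢ c ⟧) * (⟦ e ≢ a ⟧ * ⟦ e ≢ signed t d ⟧))
  𝟙-proper-gem s t a b c d e = begin
    𝟙 (proper? (gem s t) (a ∷ b ∷ c ∷ d ∷ e ∷ []))
      ≡⟨ 𝟙-⇔ (proper-gem⇔ s t a b c d e)
             (proper? (gem s t) (a ∷ b ∷ c ∷ d ∷ e ∷ [])) (gemProper? s t a b c d e) ⟩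
    𝟙 ((c ≢? a ×-dec D?) ×-dec B? ×-dec E?)
      ≡⟨ 𝟙-× (c ≢? a ×-dec D?) (B? ×-dec E?) ⟩
    𝟙 (c ≢? a ×-dec D?) * 𝟙 (B? ×-dec E?)
      ≡⟨ cong₂ _*_ (trans (𝟙-× (c ≢? a) D?) (cong (_*_ ⟦ c ≢ a ⟧) (𝟙-× (d ≢? a) (d ≢? signed s c))))
                   (trans (𝟙-× B? E?)
                          (cong₂ _*_ (𝟙-× (b ≢? a) (b ≢? c)) (𝟙-× (e ≢? a) (e ≢? signed t d)))) ⟩
    (⟦ c ≢ a ⟧ * (⟦ d ≢ a ⟧ * ⟦ d ≢ signed s c ⟧)) * ((⟦ b ≢ a ⟧ * ⟦ b ≢ c ⟧) * (⟦ e ≢ a ⟧ * ⟦ e ≢ signed t d ⟧)) ∎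
    where
    open ≡-Reasoning
    D? : Dec (d ≢ a × d ≢ signed s c)
    D? = d ≢? a ×-dec d ≢? signed s c
    B? : Dec (b ≢ a × b ≢ c)
    B? = b ≢? a ×-dec b ≢? c
    E? : Dec (e ≢ a × e ≢ signed t d)
    E? = e ≢? a ×-dec e ≢? signed t d

  record ColourSet (L : List ℤ) : Set where
    field
      unique     : Unique L
      neg-closed : ∀ {x} → x ∈ L → - x ∈ L

  colourings : ∀ {n} → SignedGraph n → List ℤ → ℕ
  colourings {n} g L = length (filter (proper? g) (assignments n L))

  -- In gemCount n z, n is the number of colours and z the number of colours x with - x ≢ x.
  gemCount : ℤ → ℤ → ℤ
  gemCount n z = (n - + 2) * (n - + 2) * (n * (n - + 1) * (n - + 2) + z)

  module GemColourings {L : List ℤ} (colours : ColourSet L) where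
    open ColourSet colours
    open ≡-Reasoning

    N N₋₁ N₋₂ : ℤ
    N   = + length L
    N₋₁ = N - + 1
    N₋₂ = N - + 2

    signed-closed : ∀ s {x} → x ∈ L → signed s x ∈ L
    signed-closed ⊕ x∈ = x∈
    signed-closed ⊖ x∈ = neg-closed x∈

    -- The number of colourings of v₄ and v₅ extending v₁ ↦ a and v₃ ↦ c.
    colourings₄₅ : Sign → Sign → ℤ → ℤ → ℤ
    colourings₄₅ s t a c = ∑[ d ∈ L ] ⟦ d ≢ a ⟧ * (⟦ d ≢ signed s c ⟧ * (N₋₂ + ⟦ a ≡ signed t d ⟧))

    Colourings₃₄₅ : Sign → Sign → Set
    Colourings₃₄₅ s t = ∀ {a} → a ∈ L →
      ∑[ c ∈ L ] ⟦ c ≢ a ⟧ * colourings₄₅ s t a c ≡ N₋₂ * (N₋₂ * N₋₁ + ⟦ - a ≢ a ⟧)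

    sum-out-v₂-v₅ : ∀ s t {a c d} → a ∈ L → c ∈ L → d ∈ L →
      ∑[ b ∈ L ] ∑[ e ∈ L ] 𝟙 (proper? (gem s t) (a ∷ b ∷ c ∷ d ∷ e ∷ [])) ≡
      N₋₂ * (⟦ c ≢ a ⟧ * (⟦ d ≢ a ⟧ * (⟦ d ≢ signed s c ⟧ * (N₋₂ + ⟦ a ≡ signed t d ⟧))))
    sum-out-v₂-v₅ s t {a} {c} {d} a∈ c∈ d∈ = begin
      ∑[ b ∈ L ] ∑[ e ∈ L ] 𝟙 (proper? (gem s t) (a ∷ b ∷ c ∷ d ∷ e ∷ []))
        ≡⟨ ∑-cong L (λ {b} _ → ∑-cong L λ {e} _ → 𝟙-proper-gem s t a b c d e) ⟩
      ∑[ b ∈ L ] ∑[ e ∈ L ] (⟦ c ≢ a ⟧ * D) * ((⟦ b ≢ a ⟧ * ⟦ b ≢ c ⟧) * (⟦ e ≢ a ⟧ * ⟦ e ≢ signed t d ⟧))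
        ≡⟨ ∑-∑-factor L L (⟦ c ≢ a ⟧ * D) _ _ ⟩
      (⟦ c ≢ a ⟧ * D) * ((∑[ b ∈ L ] ⟦ b ≢ a ⟧ * ⟦ b ≢ c ⟧) * (∑[ e ∈ L ] ⟦ e ≢ a ⟧ * ⟦ e ≢ signed t d ⟧))
        ≡⟨ cong (_*_ (⟦ c ≢ a ⟧ * D))
                (cong₂ _*_ (count-≢₂ unique a∈ c∈) (count-≢₂ unique a∈ (signed-closed t d∈))) ⟩
      (⟦ c ≢ a ⟧ * D) * ((N₋₂ + ⟦ a ≡ c ⟧) * E)
        ≡⟨ *-assoc ⟦ c ≢ a ⟧ D _ ⟩
      ⟦ c ≢ a ⟧ * (D * ((N₋₂ + ⟦ a ≡ c ⟧) * E))
        ≡⟨ ⟦≢⟧-cong c a (λ c≢a → cong (λ δ → D * ((N₋₂ + δ) * E)) (⟦≡⟧-off c≢a)) ⟩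
      ⟦ c ≢ a ⟧ * (D * ((N₋₂ + + 0) * E))
        ≡⟨ ring ⟦ c ≢ a ⟧ ⟦ d ≢ a ⟧ ⟦ d ≢ signed s c ⟧ N₋₂ E ⟩
      N₋₂ * (⟦ c ≢ a ⟧ * (⟦ d ≢ a ⟧ * (⟦ d ≢ signed s c ⟧ * E))) ∎
      where
      D E : ℤ
      D = ⟦ d ≢ a ⟧ * ⟦ d ≢ signed s c ⟧
      E = N₋₂ + ⟦ a ≡ signed t d ⟧
      ring : ∀ x y z n e → x * (y * z * ((n + + 0) * e)) ≡ n * (x * (y * (z * e)))
      ring = solve-∀

    colourings-gem : ∀ s t →
      + colourings (gem s t) L ≡ N₋₂ * (∑[ a ∈ L ] ∑[ c ∈ L ] ⟦ c ≢ a ⟧ * colourings₄₅ s t a c)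
    colourings-gem s t = begin
      + colourings (gem s t) L
        ≡⟨ length-filter (proper? (gem s t)) (assignments 5 L) ⟩
      ∑[ κ ∈ assignments 5 L ] 𝟙 (proper? (gem s t) κ)
        ≡⟨ ∑-assignments-gem L _ ⟩
      ∑[ a ∈ L ] ∑[ c ∈ L ] ∑[ d ∈ L ] ∑[ b ∈ L ] ∑[ e ∈ L ] 𝟙 (proper? (gem s t) (a ∷ b ∷ c ∷ d ∷ e ∷ []))
        ≡⟨ ∑-cong L (λ a∈ → ∑-cong L λ c∈ → ∑-cong L λ d∈ → sum-out-v₂-v₅ s t a∈ c∈ d∈) ⟩
      ∑[ a ∈ L ] ∑[ c ∈ L ] ∑[ d ∈ L ] N₋₂ * (⟦ c ≢ a ⟧ * term a c d)
        ≡⟨ ∑-cong L (λ {a} _ → trans (∑-cong L λ {c} _ → pull-out a c) (∑-*ˡ L N₋₂ _)) ⟩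
      ∑[ a ∈ L ] N₋₂ * (∑[ c ∈ L ] ⟦ c ≢ a ⟧ * colourings₄₅ s t a c)
        ≡⟨ ∑-*ˡ L N₋₂ _ ⟩
      N₋₂ * (∑[ a ∈ L ] ∑[ c ∈ L ] ⟦ c ≢ a ⟧ * colourings₄₅ s t a c) ∎
      where
      term : ℤ → ℤ → ℤ → ℤ
      term a c d = ⟦ d ≢ a ⟧ * (⟦ d ≢ signed s c ⟧ * (N₋₂ + ⟦ a ≡ signed t d ⟧))
      pull-out : ∀ a c → ∑[ d ∈ L ] N₋₂ * (⟦ c ≢ a ⟧ * term a c d) ≡ N₋₂ * (⟦ c ≢ a ⟧ * colourings₄₅ s t a c)
      pull-out a c = trans (∑-*ˡ L N₋₂ _) (cong (_*_ N₋₂) (∑-*ˡ L ⟦ c ≢ a ⟧ (term a c)))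

    colourings-gem-count : ∀ s t → Colourings₃₄₅ s t →
      + colourings (gem s t) L ≡ gemCount N (∑[ a ∈ L ] ⟦ - a ≢ a ⟧)
    colourings-gem-count s t colourings₃₄₅ = begin
      + colourings (gem s t) L
        ≡⟨ colourings-gem s t ⟩
      N₋₂ * (∑[ a ∈ L ] ∑[ c ∈ L ] ⟦ c ≢ a ⟧ * colourings₄₅ s t a c)
        ≡⟨ cong (_*_ N₋₂) (∑-cong L colourings₃₄₅) ⟩
      N₋₂ * (∑[ a ∈ L ] N₋₂ * (N₋₂ * N₋₁ + ⟦ - a ≢ a ⟧))
        ≡⟨ cong (_*_ N₋₂) (trans (∑-*ˡ L N₋₂ _) (cong (_*_ N₋₂)
             (trans (∑-distrib-+ L (λ _ → N₋₂ * N₋₁) (λ a → ⟦ - a ≢ a ⟧))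
                    (cong (_+ z) (∑-const L _))))) ⟩
      N₋₂ * (N₋₂ * (N * (N₋₂ * N₋₁) + z))
        ≡⟨ ring N z ⟩
      gemCount N z ∎
      where
      z : ℤ
      z = ∑[ a ∈ L ] ⟦ - a ≢ a ⟧
      ring : ∀ n w → (n - + 2) * ((n - + 2) * (n * ((n - + 2) * (n - + 1)) + w)) ≡
                     (n - + 2) * (n - + 2) * (n * (n - + 1) * (n - + 2) + w)
      ring = solve-∀

    colourings₄₅-⊕⊖ : ∀ {a c} → a ∈ L → c ∈ L →
      colourings₄₅ ⊕ ⊖ a c ≡ N₋₂ * (N₋₂ + ⟦ a ≡ c ⟧) + ⟦ - a ≢ a ⟧ * ⟦ - a ≢ c ⟧
    colourings₄₅-⊕⊖ {a} {c} a∈ c∈ = begin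
      colourings₄₅ ⊕ ⊖ a c
        ≡⟨ ∑-cong L (λ {d} _ → split d) ⟩
      ∑[ d ∈ L ] N₋₂ * (⟦ d ≢ a ⟧ * ⟦ d ≢ c ⟧) + ⟦ d ≡ - a ⟧ * (⟦ d ≢ a ⟧ * ⟦ d ≢ c ⟧)
        ≡⟨ ∑-distrib-+ L _ _ ⟩
      (∑[ d ∈ L ] N₋₂ * (⟦ d ≢ a ⟧ * ⟦ d ≢ c ⟧)) + (∑[ d ∈ L ] ⟦ d ≡ - a ⟧ * (⟦ d ≢ a ⟧ * ⟦ d ≢ c ⟧))
        ≡⟨ cong₂ _+_ (trans (∑-*ˡ L N₋₂ _) (cong (_*_ N₋₂) (count-≢₂ unique a∈ c∈)))
                     (∑-sift unique (neg-closed a∈) (λ d → ⟦ d ≢ a ⟧ * ⟦ d ≢ c ⟧)) ⟩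
      N₋₂ * (N₋₂ + ⟦ a ≡ c ⟧) + ⟦ - a ≢ a ⟧ * ⟦ - a ≢ c ⟧ ∎
      where
      split : ∀ d → ⟦ d ≢ a ⟧ * (⟦ d ≢ c ⟧ * (N₋₂ + ⟦ a ≡ - d ⟧)) ≡
                    N₋₂ * (⟦ d ≢ a ⟧ * ⟦ d ≢ c ⟧) + ⟦ d ≡ - a ⟧ * (⟦ d ≢ a ⟧ * ⟦ d ≢ c ⟧)
      split d = trans (cong (λ δ → ⟦ d ≢ a ⟧ * (⟦ d ≢ c ⟧ * (N₋₂ + δ))) (⟦≡-⟧-swap a d))
                      (ring ⟦ d ≢ a ⟧ ⟦ d ≢ c ⟧ N₋₂ ⟦ d ≡ - a ⟧)
        where
        ring : ∀ x y n δ → x * (y * (n + δ)) ≡ n * (x * y) + δ * (x * y)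
        ring = solve-∀

    colourings₃₄₅-⊕⊖ : Colourings₃₄₅ ⊕ ⊖
    colourings₃₄₅-⊕⊖ {a} a∈ = begin
      ∑[ c ∈ L ] ⟦ c ≢ a ⟧ * colourings₄₅ ⊕ ⊖ a c
        ≡⟨ ∑-cong L (λ {c} c∈ → cong (_*_ ⟦ c ≢ a ⟧) (colourings₄₅-⊕⊖ a∈ c∈)) ⟩
      ∑[ c ∈ L ] ⟦ c ≢ a ⟧ * (N₋₂ * (N₋₂ + ⟦ a ≡ c ⟧) + ⟦ - a ≢ a ⟧ * ⟦ - a ≢ c ⟧)
        ≡⟨ ∑-≢-cong L a (λ {c} c≢a → cong₂ (λ δ e → N₋₂ * (N₋₂ + δ) + ⟦ - a ≢ a ⟧ * e)
                                            (⟦≡⟧-off c≢a) (⟦≢⟧-sym (- a) c)) ⟩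
      ∑[ c ∈ L ] ⟦ c ≢ a ⟧ * (N₋₂ * (N₋₂ + + 0) + ⟦ - a ≢ a ⟧ * ⟦ c ≢ - a ⟧)
        ≡⟨ ∑-cong L (λ {c} _ → ring ⟦ c ≢ a ⟧ N₋₂ ⟦ - a ≢ a ⟧ ⟦ c ≢ - a ⟧) ⟩
      ∑[ c ∈ L ] N₋₂ * N₋₂ * ⟦ c ≢ a ⟧ + ⟦ - a ≢ a ⟧ * (⟦ c ≢ a ⟧ * ⟦ c ≢ - a ⟧)
        ≡⟨ ∑-distrib-+ L _ _ ⟩
      (∑[ c ∈ L ] N₋₂ * N₋₂ * ⟦ c ≢ a ⟧) + (∑[ c ∈ L ] ⟦ - a ≢ a ⟧ * (⟦ c ≢ a ⟧ * ⟦ c ≢ - a ⟧))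
        ≡⟨ cong₂ _+_ (trans (∑-*ˡ L (N₋₂ * N₋₂) (λ c → ⟦ c ≢ a ⟧))
                            (cong (_*_ (N₋₂ * N₋₂)) (count-≢ unique a∈)))
                     (trans (∑-*ˡ L ⟦ - a ≢ a ⟧ (λ c → ⟦ c ≢ a ⟧ * ⟦ c ≢ - a ⟧))
                            (cong (_*_ ⟦ - a ≢ a ⟧) (count-≢₂ unique a∈ (neg-closed a∈)))) ⟩
      N₋₂ * N₋₂ * N₋₁ + ⟦ - a ≢ a ⟧ * (N₋₂ + ⟦ a ≡ - a ⟧)
        ≡⟨ cong (_+_ (N₋₂ * N₋₂ * N₋₁))
                (⟦≢⟧-cong (- a) a (λ -a≢a → cong (_+_ N₋₂) (⟦≡⟧-off -a≢a))) ⟩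
      N₋₂ * N₋₂ * N₋₁ + ⟦ - a ≢ a ⟧ * (N₋₂ + + 0)
        ≡⟨ ring′ N₋₂ N₋₁ ⟦ - a ≢ a ⟧ ⟩
      N₋₂ * (N₋₂ * N₋₁ + ⟦ - a ≢ a ⟧) ∎
      where
      ring : ∀ x n e y → x * (n * (n + + 0) + e * y) ≡ n * n * x + e * (x * y)
      ring = solve-∀
      ring′ : ∀ n m e → n * n * m + e * (n + + 0) ≡ n * (n * m + e)
      ring′ = solve-∀

    colourings₄₅-⊖⊕ : ∀ {a c} → a ∈ L → c ∈ L → colourings₄₅ ⊖ ⊕ a c ≡ (N₋₂ + ⟦ a ≡ - c ⟧) * N₋₂
    colourings₄₅-⊖⊕ {a} {c} a∈ c∈ = begin
      colourings₄₅ ⊖ ⊕ a c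
        ≡⟨ ∑-≢-cong L a (λ {d} d≢a → cong (λ δ → ⟦ d ≢ - c ⟧ * (N₋₂ + δ)) (⟦≡⟧-off d≢a)) ⟩
      ∑[ d ∈ L ] ⟦ d ≢ a ⟧ * (⟦ d ≢ - c ⟧ * (N₋₂ + + 0))
        ≡⟨ ∑-cong L (λ {d} _ → ring ⟦ d ≢ a ⟧ ⟦ d ≢ - c ⟧ N₋₂) ⟩
      ∑[ d ∈ L ] ⟦ d ≢ a ⟧ * ⟦ d ≢ - c ⟧ * N₋₂
        ≡⟨ ∑-*ʳ L N₋₂ _ ⟩
      (∑[ d ∈ L ] ⟦ d ≢ a ⟧ * ⟦ d ≢ - c ⟧) * N₋₂
        ≡⟨ cong (_* N₋₂) (count-≢₂ unique a∈ (neg-closed c∈)) ⟩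
      (N₋₂ + ⟦ a ≡ - c ⟧) * N₋₂ ∎
      where
      ring : ∀ x y n → x * (y * (n + + 0)) ≡ x * y * n
      ring = solve-∀

    colourings₃₄₅-⊖⊕ : Colourings₃₄₅ ⊖ ⊕
    colourings₃₄₅-⊖⊕ {a} a∈ = begin
      ∑[ c ∈ L ] ⟦ c ≢ a ⟧ * colourings₄₅ ⊖ ⊕ a c
        ≡⟨ ∑-cong L (λ {c} c∈ → trans (cong (_*_ ⟦ c ≢ a ⟧) (colourings₄₅-⊖⊕ a∈ c∈)) (split c)) ⟩
      ∑[ c ∈ L ] N₋₂ * N₋₂ * ⟦ c ≢ a ⟧ + N₋₂ * (⟦ c ≡ - a ⟧ * ⟦ c ≢ a ⟧)
        ≡⟨ ∑-distrib-+ L _ _ ⟩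
      (∑[ c ∈ L ] N₋₂ * N₋₂ * ⟦ c ≢ a ⟧) + (∑[ c ∈ L ] N₋₂ * (⟦ c ≡ - a ⟧ * ⟦ c ≢ a ⟧))
        ≡⟨ cong₂ _+_ (trans (∑-*ˡ L (N₋₂ * N₋₂) (λ c → ⟦ c ≢ a ⟧))
                            (cong (_*_ (N₋₂ * N₋₂)) (count-≢ unique a∈)))
                     (trans (∑-*ˡ L N₋₂ (λ c → ⟦ c ≡ - a ⟧ * ⟦ c ≢ a ⟧))
                            (cong (_*_ N₋₂) (∑-sift unique (neg-closed a∈) (λ c → ⟦ c ≢ a ⟧)))) ⟩
      N₋₂ * N₋₂ * N₋₁ + N₋₂ * ⟦ - a ≢ a ⟧
        ≡⟨ ring N₋₂ N₋₁ ⟦ - a ≢ a ⟧ ⟩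
      N₋₂ * (N₋₂ * N₋₁ + ⟦ - a ≢ a ⟧) ∎
      where
      split : ∀ c → ⟦ c ≢ a ⟧ * ((N₋₂ + ⟦ a ≡ - c ⟧) * N₋₂) ≡
                    N₋₂ * N₋₂ * ⟦ c ≢ a ⟧ + N₋₂ * (⟦ c ≡ - a ⟧ * ⟦ c ≢ a ⟧)
      split c = trans (cong (λ δ → ⟦ c ≢ a ⟧ * ((N₋₂ + δ) * N₋₂)) (⟦≡-⟧-swap a c))
                      (ring′ ⟦ c ≢ a ⟧ N₋₂ ⟦ c ≡ - a ⟧)
        where
        ring′ : ∀ x n δ → x * ((n + δ) * n) ≡ n * n * x + n * (δ * x)
        ring′ = solve-∀
      ring : ∀ n m e → n * n * m + n * e ≡ n * (n * m + e)
      ring = solve-∀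

  HasGemCount : SignedGraph 5 → Set
  HasGemCount g = ∀ {L} → ColourSet L → + colourings g L ≡ gemCount (+ length L) (∑[ x ∈ L ] ⟦ - x ≢ x ⟧)

  G₁-count : HasGemCount G₁
  G₁-count colours = colourings-gem-count ⊕ ⊖ colourings₃₄₅-⊕⊖
    where open GemColourings colours

  G₂-count : HasGemCount G₂
  G₂-count colours = colourings-gem-count ⊖ ⊕ colourings₃₄₅-⊖⊕
    where open GemColourings colours

  ∈-nonzeroUpTo⁺ : ∀ k {i} → i ∈ upTo k → + suc i ∈ nonzeroUpTo k × -[1+ i ] ∈ nonzeroUpTo k
  ∈-nonzeroUpTo⁺ k i∈ = ∈-++⁺ˡ (∈-map⁺ (λ i → + suc i) i∈) , ∈-++⁺ʳ _ (∈-map⁺ -[1+_] i∈)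

  ∈-nonzeroUpTo⁻ : ∀ k {x} → x ∈ nonzeroUpTo k → ∃[ i ] i ∈ upTo k × (x ≡ + suc i ⊎ x ≡ -[1+ i ])
  ∈-nonzeroUpTo⁻ k x∈ with ∈-++⁻ (map (λ i → + suc i) (upTo k)) x∈
  ... | inj₁ x∈⁺ with i , i∈ , refl ← ∈-map⁻ (λ i → + suc i) x∈⁺ = i , i∈ , inj₁ refl
  ... | inj₂ x∈⁻ with i , i∈ , refl ← ∈-map⁻ -[1+_] x∈⁻ = i , i∈ , inj₂ refl

  nonzeroUpTo-neg-closed : ∀ k {x} → x ∈ nonzeroUpTo k → - x ∈ nonzeroUpTo k
  nonzeroUpTo-neg-closed k x∈ with ∈-nonzeroUpTo⁻ k x∈
  ... | _ , i∈ , inj₁ refl = proj₂ (∈-nonzeroUpTo⁺ k i∈)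
  ... | _ , i∈ , inj₂ refl = proj₁ (∈-nonzeroUpTo⁺ k i∈)

  nonzeroUpTo-unpaired : ∀ k {x} → x ∈ nonzeroUpTo k → ⟦ - x ≢ x ⟧ ≡ + 1
  nonzeroUpTo-unpaired k x∈ with ∈-nonzeroUpTo⁻ k x∈
  ... | _ , _ , inj₁ refl = refl
  ... | _ , _ , inj₂ refl = refl

  0∉nonzeroUpTo : ∀ k → All (+ 0 ≢_) (nonzeroUpTo k)
  0∉nonzeroUpTo k = All.tabulate nonzero
    where
    nonzero : ∀ {x} → x ∈ nonzeroUpTo k → + 0 ≢ x
    nonzero x∈ with ∈-nonzeroUpTo⁻ k x∈
    ... | _ , _ , inj₁ refl = λ ()
    ... | _ , _ , inj₂ refl = λ ()

  nonzeroUpTo-unique : ∀ k → Unique (nonzeroUpTo k)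
  nonzeroUpTo-unique k =
    Unique.++⁺ (Unique.map⁺ +[1+-injective (Unique.upTo⁺ k))
               (Unique.map⁺ -[1+-injective (Unique.upTo⁺ k))
               disjoint
    where
    disjoint : ∀ {x} → ¬ (x ∈ map (λ i → + suc i) (upTo k) × x ∈ map -[1+_] (upTo k))
    disjoint (x∈⁺ , x∈⁻) with _ , _ , refl ← ∈-map⁻ (λ i → + suc i) x∈⁺ with _ , _ , () ← ∈-map⁻ -[1+_] x∈⁻

  length-nonzeroUpTo : ∀ k → length (nonzeroUpTo k) ≡ 2 ℕ.* k
  length-nonzeroUpTo k = begin
    length (nonzeroUpTo k)
      ≡⟨ length-++ (map (λ i → + suc i) (upTo k)) ⟩
    length (map (λ i → + suc i) (upTo k)) ℕ.+ length (map -[1+_] (upTo k))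
      ≡⟨ cong₂ ℕ._+_ (trans (length-map _ (upTo k)) (length-upTo k))
                     (trans (length-map _ (upTo k)) (length-upTo k)) ⟩
    k ℕ.+ k
      ≡⟨ cong (k ℕ.+_) (sym (ℕ.+-identityʳ k)) ⟩
    2 ℕ.* k ∎
    where open ≡-Reasoning

  ∑-nonzeroUpTo-unpaired : ∀ k → ∑[ x ∈ nonzeroUpTo k ] ⟦ - x ≢ x ⟧ ≡ + (2 ℕ.* k)
  ∑-nonzeroUpTo-unpaired k =
    trans (∑-cong (nonzeroUpTo k) (nonzeroUpTo-unpaired k))
          (trans (∑-const (nonzeroUpTo k) (+ 1)) (trans (*-identityʳ _) (cong +_ (length-nonzeroUpTo k))))

  even-colours : ∀ k → ColourSet (nonzeroUpTo k)
  even-colours k = record { unique = nonzeroUpTo-unique k ; neg-closed = nonzeroUpTo-neg-closed k }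

  odd-colours : ∀ k → ColourSet (+ 0 ∷ nonzeroUpTo k)
  odd-colours k = record { unique = 0∉nonzeroUpTo k ∷ nonzeroUpTo-unique k ; neg-closed = neg-closed }
    where
    neg-closed : ∀ {x} → x ∈ + 0 ∷ nonzeroUpTo k → - x ∈ + 0 ∷ nonzeroUpTo k
    neg-closed (here refl) = here refl
    neg-closed (there x∈)  = there (nonzeroUpTo-neg-closed k x∈)

  C-even-case : ∀ l → l % 2 ≡ 0 → C l ≡ nonzeroUpTo (l / 2)
  C-even-case l l%2≡0 rewrite l%2≡0 = refl

  C-odd-case : ∀ l → l % 2 ≡ 1 → C l ≡ + 0 ∷ nonzeroUpTo (l / 2)
  C-odd-case l l%2≡1 rewrite l%2≡1 = refl

  C-even : ∀ k → C (2 ℕ.* k) ≡ nonzeroUpTo k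
  C-even k = begin
    C (2 ℕ.* k)                ≡⟨ cong C (ℕ.*-comm 2 k) ⟩
    C (k ℕ.* 2)                ≡⟨ C-even-case (k ℕ.* 2) (m*n%n≡0 k 2) ⟩
    nonzeroUpTo (k ℕ.* 2 / 2)  ≡⟨ cong nonzeroUpTo (m*n/n≡m k 2) ⟩
    nonzeroUpTo k              ∎
    where open ≡-Reasoning

  C-odd : ∀ k → C (suc (2 ℕ.* k)) ≡ + 0 ∷ nonzeroUpTo k
  C-odd k = begin
    C (suc (2 ℕ.* k))                        ≡⟨ cong (C ∘ suc) (ℕ.*-comm 2 k) ⟩
    C (1 ℕ.+ k ℕ.* 2)                        ≡⟨ C-odd-case (1 ℕ.+ k ℕ.* 2) ([m+kn]%n≡m%n 1 k 2) ⟩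
    + 0 ∷ nonzeroUpTo ((1 ℕ.+ k ℕ.* 2) / 2)  ≡⟨ cong (λ m → + 0 ∷ nonzeroUpTo m) half ⟩
    + 0 ∷ nonzeroUpTo k                      ∎
    where
    open ≡-Reasoning
    half : (1 ℕ.+ k ℕ.* 2) / 2 ≡ k
    half = trans (+-distrib-/-∣ʳ 1 {d = 2} (divides k refl)) (m*n/n≡m k 2)

  gemCount-even : ∀ x → gemCount x x ≡ Epoly x
  gemCount-even = ring
    where
    ring : ∀ x → (x - + 2) * (x - + 2) * (x * (x - + 1) * (x - + 2) + x) ≡
                 x * ((x - + 2) * (x - + 2)) * (x * x - + 3 * x + + 3)
    ring = solve-∀

  gemCount-odd : ∀ y → gemCount (+ 1 + y) y ≡ Opoly (+ 1 + y)
  gemCount-odd = ring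
    where
    ring : ∀ y → (+ 1 + y - + 2) * (+ 1 + y - + 2) * ((+ 1 + y) * (+ 1 + y - + 1) * (+ 1 + y - + 2) + y) ≡
                 (+ 1 + y - + 1) * (+ 1 + y - + 1) * (+ 1 + y - + 1) * ((+ 1 + y - + 2) * (+ 1 + y - + 2))
    ring = solve-∀

  even-chromatic : ∀ {g} → HasGemCount g → ∀ k → + f g (2 ℕ.* k) ≡ Epoly (+ (2 ℕ.* k))
  even-chromatic {g} count k = begin
    + colourings g (C (2 ℕ.* k))
      ≡⟨ cong (λ L → + colourings g L) (C-even k) ⟩
    + colourings g (nonzeroUpTo k)
      ≡⟨ count (even-colours k) ⟩
    gemCount (+ length (nonzeroUpTo k)) (∑[ x ∈ nonzeroUpTo k ] ⟦ - x ≢ x ⟧)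
      ≡⟨ cong₂ gemCount (cong +_ (length-nonzeroUpTo k)) (∑-nonzeroUpTo-unpaired k) ⟩
    gemCount (+ (2 ℕ.* k)) (+ (2 ℕ.* k))
      ≡⟨ gemCount-even (+ (2 ℕ.* k)) ⟩
    Epoly (+ (2 ℕ.* k)) ∎
    where open ≡-Reasoning

  odd-chromatic : ∀ {g} → HasGemCount g → ∀ k → + f g (suc (2 ℕ.* k)) ≡ Opoly (+ suc (2 ℕ.* k))
  odd-chromatic {g} count k = begin
    + colourings g (C (suc (2 ℕ.* k)))
      ≡⟨ cong (λ L → + colourings g L) (C-odd k) ⟩
    + colourings g (+ 0 ∷ nonzeroUpTo k)
      ≡⟨ count (odd-colours k) ⟩
    gemCount (+ suc (length (nonzeroUpTo k))) (+ 0 + (∑[ x ∈ nonzeroUpTo k ] ⟦ - x ≢ x ⟧))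
      ≡⟨ cong₂ gemCount (cong (λ n → + suc n) (length-nonzeroUpTo k))
                        (trans (+-identityˡ _) (∑-nonzeroUpTo-unpaired k)) ⟩
    gemCount (+ 1 + + (2 ℕ.* k)) (+ (2 ℕ.* k))
      ≡⟨ gemCount-odd (+ (2 ℕ.* k)) ⟩
    Opoly (+ suc (2 ℕ.* k)) ∎
    where open ≡-Reasoning

module Switching where

  open import Data.Bool using (Bool; true; false; if_then_else_; _xor_)
  import Data.Bool.Properties as Bool
  import Data.Fin.Properties as Fin
  import Data.Maybe.Properties as Maybe
  import Data.Sign.Properties as Sign
  open import Data.Sign.Properties using (*-commutativeMonoid; s*s≡+)
  open import Algebra.Solver.CommutativeMonoid *-commutativeMonoid
    using (Expr; prove; var) renaming (_⊕_ to _·_)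
  open import Data.Fin using (Fin; zero; suc)
  open import Data.Maybe using (Maybe; nothing; is-just; zipWith)
  open import Data.Vec using ([]; _∷_)
  open import Function using (Inverse)
  open import Relation.Nullary using (_→-dec_)
  open import Relation.Nullary.Decidable using (from-yes)

  pattern v₁ = zero
  pattern v₂ = suc zero
  pattern v₃ = suc (suc zero)
  pattern v₄ = suc (suc (suc zero))
  pattern v₅ = suc (suc (suc (suc zero)))

  signOf : Bool → Sign
  signOf false = ⊕
  signOf true  = ⊖

  flipIf : Bool → Sign → Sign
  flipIf b s = if b then opposite s else s

  flipIf-xor : ∀ x y s → flipIf (x xor y) s ≡ signOf x *ₛ signOf y *ₛ s
  flipIf-xor false false s = refl
  flipIf-xor false true  s = refl
  flipIf-xor true  false s = refl
  flipIf-xor true  true  s = refl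

  cycle-cancel : ∀ p q r s t u → (p *ₛ q *ₛ s) *ₛ (q *ₛ r *ₛ t) *ₛ (r *ₛ p *ₛ u) ≡ s *ₛ t *ₛ u
  cycle-cancel p q r s t u = begin
    (p *ₛ q *ₛ s) *ₛ (q *ₛ r *ₛ t) *ₛ (r *ₛ p *ₛ u)
      ≡⟨ regroup ⟩
    (p *ₛ p) *ₛ ((q *ₛ q) *ₛ ((r *ₛ r) *ₛ (s *ₛ t *ₛ u)))
      ≡⟨ cong₂ _*ₛ_ (s*s≡+ p) (cong₂ _*ₛ_ (s*s≡+ q) (cong₂ _*ₛ_ (s*s≡+ r) refl)) ⟩
    s *ₛ t *ₛ u ∎
    where
    open ≡-Reasoning
    regroup : (p *ₛ q *ₛ s) *ₛ (q *ₛ r *ₛ t) *ₛ (r *ₛ p *ₛ u) ≡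
              (p *ₛ p) *ₛ ((q *ₛ q) *ₛ ((r *ₛ r) *ₛ (s *ₛ t *ₛ u)))
    regroup = prove 6 ((((p′ · q′) · s′) · ((q′ · r′) · t′)) · ((r′ · p′) · u′))
                      ((p′ · p′) · ((q′ · q′) · ((r′ · r′) · ((s′ · t′) · u′))))
                      (p ∷ q ∷ r ∷ s ∷ t ∷ u ∷ [])
      where
      p′ q′ r′ s′ t′ u′ : Expr 6
      p′ = var zero
      q′ = var (suc zero)
      r′ = var (suc (suc zero))
      s′ = var (suc (suc (suc zero)))
      t′ = var (suc (suc (suc (suc zero))))
      u′ = var (suc (suc (suc (suc (suc zero)))))

  switched-triangle : ∀ x y z s t u →
    flipIf (x xor y) s *ₛ flipIf (y xor z) t *ₛ flipIf (z xor x) u ≡ s *ₛ t *ₛ u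
  switched-triangle x y z s t u =
    trans (cong₂ _*ₛ_ (cong₂ _*ₛ_ (flipIf-xor x y s) (flipIf-xor y z t)) (flipIf-xor z x u))
          (cycle-cancel (signOf x) (signOf y) (signOf z) s t u)

  triangleSign : ∀ {n} → SignedGraph n → Fin n → Fin n → Fin n → Maybe Sign
  triangleSign g a b c = zipWith _*ₛ_ (zipWith _*ₛ_ (g a b) (g b c)) (g c a)

  triangleSign-switch : ∀ {n} (X : Fin n → Bool) g a b c →
                        triangleSign (switch X g) a b c ≡ triangleSign g a b c
  triangleSign-switch X g a b c with g a b | g b c | g c a
  ... | just s  | just t  | just u  = cong just (switched-triangle (X a) (X b) (X c) s t u)
  ... | just _  | just _  | nothing = refl
  ... | just _  | nothing | _       = refl
  ... | nothing | _       | _       = refl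

  is-just-switch : ∀ {n} (X : Fin n → Bool) g u v → is-just (switch X g u v) ≡ is-just (g u v)
  is-just-switch X g u v with g u v
  ... | just _  = refl
  ... | nothing = refl

  module SwitchingIsomorphism {n} {g₁ g₂ : SignedGraph n} (iso : SwitchingIsomorphic g₁ g₂) where
    φ φ⁻¹ : Fin n → Fin n
    φ   = Inverse.to (proj₁ iso)
    φ⁻¹ = Inverse.from (proj₁ iso)

    φ∘φ⁻¹ : ∀ w → φ (φ⁻¹ w) ≡ w
    φ∘φ⁻¹ = Inverse.strictlyInverseˡ (proj₁ iso)

    preserves-adjacency : ∀ u v → is-just (g₁ u v) ≡ is-just (g₂ (φ u) (φ v))
    preserves-adjacency u v =
      trans (cong is-just (proj₂ (proj₂ iso) u v)) (is-just-switch (proj₁ (proj₂ iso)) g₂ (φ u) (φ v))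

    preserves-triangleSign : ∀ a b c → triangleSign g₁ a b c ≡ triangleSign g₂ (φ a) (φ b) (φ c)
    preserves-triangleSign a b c rewrite proj₂ (proj₂ iso) a b | proj₂ (proj₂ iso) b c | proj₂ (proj₂ iso) c a =
      triangleSign-switch (proj₁ (proj₂ iso)) g₂ (φ a) (φ b) (φ c)

  G₁-neighbours-v₅ : ∀ u → is-just (G₁ v₅ u) ≡ true → u ≡ v₁ ⊎ u ≡ v₄
  G₁-neighbours-v₅ v₁ _ = inj₁ refl
  G₁-neighbours-v₅ v₄ _ = inj₂ refl
  G₁-neighbours-v₅ v₂ ()
  G₁-neighbours-v₅ v₃ ()
  G₁-neighbours-v₅ v₅ ()

  G₂-negative-triangle-third-neighbour : ∀ a b c → triangleSign G₂ a b c ≡ just ⊖ →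
    ∃[ w ] is-just (G₂ c w) ≡ true × w ≢ a × w ≢ b
  G₂-negative-triangle-third-neighbour = from-yes
    (Fin.all? λ a → Fin.all? λ b → Fin.all? λ c →
       Maybe.≡-dec Sign._≟_ (triangleSign G₂ a b c) (just ⊖) →-dec
       Fin.any? λ w → (is-just (G₂ c w) Bool.≟ true) ×-dec ¬? (w Fin.≟ a) ×-dec ¬? (w Fin.≟ b))

  G₁≁G₂ : ¬ SwitchingIsomorphic G₁ G₂
  G₁≁G₂ iso = no-third-neighbour
    (G₂-negative-triangle-third-neighbour (φ v₁) (φ v₄) (φ v₅) (sym (preserves-triangleSign v₁ v₄ v₅)))
    where
    open SwitchingIsomorphism {g₁ = G₁} {g₂ = G₂} iso
    no-third-neighbour : ¬ (∃[ w ] is-just (G₂ (φ v₅) w) ≡ true × w ≢ φ v₁ × w ≢ φ v₄)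
    no-third-neighbour (w , adjacent , w≢φv₁ , w≢φv₄)
      with G₁-neighbours-v₅ (φ⁻¹ w)
             (trans (preserves-adjacency v₅ (φ⁻¹ w)) (trans (cong (is-just ∘ G₂ (φ v₅)) (φ∘φ⁻¹ w)) adjacent))
    ... | inj₁ φ⁻¹w≡v₁ = w≢φv₁ (trans (sym (φ∘φ⁻¹ w)) (cong φ φ⁻¹w≡v₁))
    ... | inj₂ φ⁻¹w≡v₄ = w≢φv₄ (trans (sym (φ∘φ⁻¹ w)) (cong φ φ⁻¹w≡v₄))

open ChromaticCounts using (G₁-count; G₂-count; even-chromatic; odd-chromatic)
open Switching using (G₁≁G₂)
open import Data.Nat using (_*_)
open import Data.Integer using (+_)

mainTheorem1 :
    ¬ SwitchingIsomorphic G₁ G₂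
    × (∀ k → + f G₁ (2 * k) ≡ Epoly (+ (2 * k)))
    × (∀ k → + f G₂ (2 * k) ≡ Epoly (+ (2 * k)))
    × (∀ k → + f G₁ (suc (2 * k)) ≡ Opoly (+ suc (2 * k)))
    × (∀ k → + f G₂ (suc (2 * k)) ≡ Opoly (+ suc (2 * k)))
mainTheorem1 =
  G₁≁G₂ , even-chromatic G₁-count , even-chromatic G₂-count , odd-chromatic G₁-count , odd-chromatic G₂-count
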